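{- Let $P$ be a propositional (quantifier-free) formula of a first-order language in which the connective $\rightarrow$ does not occur, and let $\alpha$ be a first-order variable. Then the formula $\lnot\lnot\exists \alpha\, P$ is not provable in classical first-order logic.
   Context: Formulas are built from atomic formulas and the constant $\bot$ using $\land,\lor,\rightarrow,\forall,\exists$; negation is defined by $\lnot A := A\rightarrow\bot$, so in particular $\lnot$ does not occur in a formula in which $\rightarrow$ does not occur. A propositional formula is one without quantifiers. -}

module Defs where

open import Data.Nat using (ℕ; zero; suc)
open import Data.Vec using (Vec; []; _∷_)
open import Data.List using (List; []; _∷_; map)
open import Data.List.Membership.Propositional using (_∈_)

-- A first-order signature (language without built-in equality):
-- function symbols (constants = arity 0) and relation symbols with arities.
record Signature : Set₁ where
  field
    Func     : Set
    funArity : Func → ℕ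
    Rel      : Set
    relArity : Rel → ℕ

module _ (L : Signature) where
  open Signature L

  data Term : Set where
    var : ℕ → Term
    app : (f : Func) → Vec Term (funArity f) → Term

  -- Formulas: atoms, ⊥, ∧, ∨, →, ∀, ∃ (binders use de Bruijn index 0).
  data Formula : Set where
    atom : (r : Rel) → Vec Term (relArity r) → Formula
    ⊥'   : Formula
    _∧'_ : Formula → Formula → Formula
    _∨'_ : Formula → Formula → Formula
    _⇒'_ : Formula → Formula → Formula
    ∀'   : Formula → Formula
    ∃'   : Formula → Formula

module _ {L : Signature} where
  open Signature L

  infixr 6 _∧'_ _∨'_
  infixr 5 _⇒'_

  ¬'_ : Formula L → Formula L
  ¬' A = A ⇒' ⊥'

  Sub : Set
  Sub = ℕ → Term L

  mutual
    substT : Sub → Term L → Term L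
    substT σ (var n)    = σ n
    substT σ (app f ts) = app f (substTs σ ts)

    substTs : ∀ {k} → Sub → Vec (Term L) k → Vec (Term L) k
    substTs σ []       = []
    substTs σ (t ∷ ts) = substT σ t ∷ substTs σ ts

  shiftT : Term L → Term L
  shiftT = substT (λ n → var (suc n))

  exts : Sub → Sub
  exts σ zero    = var zero
  exts σ (suc n) = shiftT (σ n)

  substF : Sub → Formula L → Formula L
  substF σ (atom r ts) = atom r (substTs σ ts)
  substF σ ⊥'          = ⊥'
  substF σ (A ∧' B)    = substF σ A ∧' substF σ B
  substF σ (A ∨' B)    = substF σ A ∨' substF σ B
  substF σ (A ⇒' B)    = substF σ A ⇒' substF σ B
  substF σ (∀' A)      = ∀' (substF (exts σ) A)
  substF σ (∃' A)      = ∃' (substF (exts σ) A)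

  shiftF : Formula L → Formula L
  shiftF = substF (λ n → var (suc n))

  inst : Formula L → Term L → Formula L
  inst A t = substF (λ { zero → t ; (suc n) → var n }) A

  infix 3 _⊢_
  data _⊢_ : List (Formula L) → Formula L → Set where
    ax    : ∀ {Γ A} → A ∈ Γ → Γ ⊢ A
    raa   : ∀ {Γ A} → (¬' A) ∷ Γ ⊢ ⊥' → Γ ⊢ A
    ∧I    : ∀ {Γ A B} → Γ ⊢ A → Γ ⊢ B → Γ ⊢ A ∧' B
    ∧E₁   : ∀ {Γ A B} → Γ ⊢ A ∧' B → Γ ⊢ A
    ∧E₂   : ∀ {Γ A B} → Γ ⊢ A ∧' B → Γ ⊢ B
    ∨I₁   : ∀ {Γ A B} → Γ ⊢ A → Γ ⊢ A ∨' B
    ∨I₂   : ∀ {Γ A B} → Γ ⊢ B → Γ ⊢ A ∨' B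
    ∨E    : ∀ {Γ A B C} → Γ ⊢ A ∨' B → A ∷ Γ ⊢ C → B ∷ Γ ⊢ C → Γ ⊢ C
    ⇒I    : ∀ {Γ A B} → A ∷ Γ ⊢ B → Γ ⊢ A ⇒' B
    ⇒E    : ∀ {Γ A B} → Γ ⊢ A ⇒' B → Γ ⊢ A → Γ ⊢ B
    ∀I    : ∀ {Γ A} → map shiftF Γ ⊢ A → Γ ⊢ ∀' A
    ∀E    : ∀ {Γ A} (t : Term L) → Γ ⊢ ∀' A → Γ ⊢ inst A t
    ∃I    : ∀ {Γ A} (t : Term L) → Γ ⊢ inst A t → Γ ⊢ ∃' A
    ∃E    : ∀ {Γ A C} → Γ ⊢ ∃' A → A ∷ map shiftF Γ ⊢ shiftF C → Γ ⊢ C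

  Provable : Formula L → Set
  Provable A = [] ⊢ A

  data Propositional : Formula L → Set where
    atom : ∀ r ts → Propositional (atom r ts)
    ⊥'   : Propositional ⊥'
    _∧'_ : ∀ {A B} → Propositional A → Propositional B → Propositional (A ∧' B)
    _∨'_ : ∀ {A B} → Propositional A → Propositional B → Propositional (A ∨' B)
    _⇒'_ : ∀ {A B} → Propositional A → Propositional B → Propositional (A ⇒' B)

  data ImpFree : Formula L → Set where
    atom : ∀ r ts → ImpFree (atom r ts)
    ⊥'   : ImpFree ⊥'
    _∧'_ : ∀ {A B} → ImpFree A → ImpFree B → ImpFree (A ∧' B)
    _∨'_ : ∀ {A B} → ImpFree A → ImpFree B → ImpFree (A ∨' B)
    ∀'   : ∀ {A} → ImpFree A → ImpFree (∀' A)
    ∃'   : ∀ {A} → ImpFree A → ImpFree (∃' A)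

-- Classical logic is sound for one-point structures, in which quantifiers are
-- vacuous and a formula is just a Boolean combination of its atoms. In the one
-- where every atom is false, a formula built from atoms and ⊥ by ∧, ∨, ∀, ∃
-- alone is false, hence ¬¬∃P is false and cannot be provable.
module Submission where

open import Defs
open import Relation.Nullary using (¬_)
open import Data.Bool using (Bool; true; false; _∧_; _∨_; T)
open import Data.Bool.Properties using (T-∧; T-∨)
open import Data.List using (map)
open import Data.List.Relation.Unary.All as All using (All; []; _∷_)
open import Data.List.Relation.Unary.All.Properties using (map⁺)
open import Data.Product using (_,_; proj₁; proj₂)
open import Data.Sum using (inj₁; inj₂; [_,_]′)
open import Function using (const)
open import Function.Bundles using (Equivalence)
open import Relation.Binary.PropositionalEquality using (_≡_; refl; cong₂; sym; subst)

open Equivalence using (to; from)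

infixr 5 _⇒ᵇ_

_⇒ᵇ_ : Bool → Bool → Bool
true  ⇒ᵇ b = b
false ⇒ᵇ _ = true

T-⇒ᵇ-intro : ∀ {a b} → (T a → T b) → T (a ⇒ᵇ b)
T-⇒ᵇ-intro {true}  f = f _
T-⇒ᵇ-intro {false} f = _

T-⇒ᵇ-elim : ∀ {a b} → T (a ⇒ᵇ b) → T a → T b
T-⇒ᵇ-elim {true} h _ = h

T-raa : ∀ {a} → ¬ T (a ⇒ᵇ false) → T a
T-raa {true}  _ = _
T-raa {false} k = k _

module _ {L : Signature} (ρ : Signature.Rel L → Bool) where

  -- Truth in the one-point structure interpreting each relation symbol r by ρ r.
  ⟦_⟧ : Formula L → Bool
  ⟦ atom r _ ⟧ = ρ r
  ⟦ ⊥' ⟧       = false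
  ⟦ A ∧' B ⟧   = ⟦ A ⟧ ∧ ⟦ B ⟧
  ⟦ A ∨' B ⟧   = ⟦ A ⟧ ∨ ⟦ B ⟧
  ⟦ A ⇒' B ⟧   = ⟦ A ⟧ ⇒ᵇ ⟦ B ⟧
  ⟦ ∀' A ⟧     = ⟦ A ⟧
  ⟦ ∃' A ⟧     = ⟦ A ⟧

  ⟦substF⟧ : ∀ σ A → ⟦ substF σ A ⟧ ≡ ⟦ A ⟧
  ⟦substF⟧ σ (atom r ts) = refl
  ⟦substF⟧ σ ⊥'          = refl
  ⟦substF⟧ σ (A ∧' B)    = cong₂ _∧_  (⟦substF⟧ σ A) (⟦substF⟧ σ B)
  ⟦substF⟧ σ (A ∨' B)    = cong₂ _∨_  (⟦substF⟧ σ A) (⟦substF⟧ σ B)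
  ⟦substF⟧ σ (A ⇒' B)    = cong₂ _⇒ᵇ_ (⟦substF⟧ σ A) (⟦substF⟧ σ B)
  ⟦substF⟧ σ (∀' A)      = ⟦substF⟧ (exts σ) A
  ⟦substF⟧ σ (∃' A)      = ⟦substF⟧ (exts σ) A

  Holds : Formula L → Set
  Holds A = T ⟦ A ⟧

  Holds-substF : ∀ {σ} A → Holds A → Holds (substF σ A)
  Holds-substF {σ} A = subst T (sym (⟦substF⟧ σ A))

  Holds-unsubstF : ∀ {σ} A → Holds (substF σ A) → Holds A
  Holds-unsubstF {σ} A = subst T (⟦substF⟧ σ A)

  All-Holds-shiftF : ∀ {Γ} → All Holds Γ → All Holds (map shiftF Γ)
  All-Holds-shiftF hs = map⁺ (All.map (λ {A} → Holds-substF A) hs)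

  soundness : ∀ {Γ A} → Γ ⊢ A → All Holds Γ → Holds A
  soundness (ax A∈Γ)         hs = All.lookup hs A∈Γ
  soundness (raa d)          hs = T-raa (λ ¬A → soundness d (¬A ∷ hs))
  soundness (∧I d e)         hs = from T-∧ (soundness d hs , soundness e hs)
  soundness (∧E₁ d)          hs = proj₁ (to T-∧ (soundness d hs))
  soundness (∧E₂ d)          hs = proj₂ (to T-∧ (soundness d hs))
  soundness (∨I₁ d)          hs = from T-∨ (inj₁ (soundness d hs))
  soundness (∨I₂ d)          hs = from T-∨ (inj₂ (soundness d hs))
  soundness (∨E d e f)       hs =
    [ (λ a → soundness e (a ∷ hs)) , (λ b → soundness f (b ∷ hs)) ]′ (to T-∨ (soundness d hs))
  soundness (⇒I d)           hs = T-⇒ᵇ-intro (λ a → soundness d (a ∷ hs))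
  soundness (⇒E d e)         hs = T-⇒ᵇ-elim (soundness d hs) (soundness e hs)
  soundness (∀I d)           hs = soundness d (All-Holds-shiftF hs)
  soundness (∀E {A = A} t d) hs = Holds-substF A (soundness d hs)
  soundness (∃I {A = A} t d) hs = Holds-unsubstF A (soundness d hs)
  soundness (∃E {C = C} d e) hs =
    Holds-unsubstF C (soundness e (soundness d hs ∷ All-Holds-shiftF hs))

impFree-refuted : ∀ {L} {P : Formula L} → ImpFree P → ¬ Holds (const false) P
impFree-refuted (atom r ts) ()
impFree-refuted ⊥'          ()
impFree-refuted (p ∧' q)    h = impFree-refuted p (proj₁ (to T-∧ h))
impFree-refuted (p ∨' q)    h = [ impFree-refuted p , impFree-refuted q ]′ (to T-∨ h)
impFree-refuted (∀' p)      h = impFree-refuted p h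
impFree-refuted (∃' p)      h = impFree-refuted p h

proposition2p2 : (L : Signature) (P : Formula L) → Propositional P → ImpFree P →
    ¬ Provable (¬' ¬' ∃' P)
proposition2p2 L P _ impFree ⊢¬¬∃P =
  T-⇒ᵇ-elim (soundness (const false) ⊢¬¬∃P []) (T-⇒ᵇ-intro (impFree-refuted impFree))
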